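{- For integers $n\ge 0$ and $k\ge 0$, let $s(n,k)$ denote the number of maximal independent sets of size exactly $k$ in the square cactus $S(n)$. Then, as formal power series in $x,y$, $$\sum_{n\ge 0}\sum_{k\ge 0} s(n,k)\,x^n y^k \;=\; \frac{1-2xy+2xy^2-2x^2y^3+x^2y^2+x^2y^4}{1-2xy+x^2y^2-x^2y^3}.$$
   Context: For $n\ge 1$, the square (ortho-rectangular) cactus $S(n)$ is the graph formed by a chain of $n$ 4-cycles $B_1,\dots,B_n$, where for each $1\le i\le n-1$ the consecutive cycles $B_i$ and $B_{i+1}$ share exactly one vertex, non-consecutive cycles share no vertex, every vertex lies in at most two cycles, and for each $2\le i\le n-1$ the two shared (cut) vertices of $B_i$ are adjacent. $S(0)$ is the empty graph, so $s(0,0)=1$ and $s(0,k)=0$ for $k\ge1$. An independent set is maximal if no further vertex can be added while keeping it independent. -}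

module Defs where

open import Data.Bool using (Bool; true; false; _∧_; _∨_; not; if_then_else_)
open import Data.Nat using (ℕ; zero; suc; _+_; _*_; _∸_; _≡ᵇ_)
open import Data.Fin using (Fin; toℕ)
open import Data.List using (List; []; _∷_; upTo; filter; length; map; foldr; _++_)
open import Data.Bool.ListAction using (any)
open import Data.Vec using (Vec; []; _∷_; lookup; _[_]≔_; allFin)
import Data.Vec as Vec
open import Data.Integer using (ℤ; +_)
import Data.Integer as ℤ
open import Data.Product using (_×_; _,_)
open import Relation.Nullary.Decidable using (does)
open import Relation.Unary using (Decidable)
open import Relation.Binary.PropositionalEquality using (_≡_)

-- For n ≥ 1, S(n) has 3n+1 vertices, labelled 0 … 3n.  For i < n the
-- 4-cycle B_{i+1} is  3i — 3i+3 — 3i+2 — 3i+1 — 3i.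
-- Consecutive cycles B_{i},B_{i+1} share exactly the vertex 3i, and
-- inside each inner cycle the two cut vertices 3i and 3i+3 are adjacent
-- (ortho arrangement).  Vertices 0 and 3n lie on a single cycle.

nV : ℕ → ℕ
nV zero    = 0
nV (suc n) = 3 * n + 4

isEdge : ℕ → ℕ → ℕ → ℕ → Bool
isEdge a b u v = ((u ≡ᵇ a) ∧ (v ≡ᵇ b)) ∨ ((u ≡ᵇ b) ∧ (v ≡ᵇ a))

cycleEdge : ℕ → ℕ → ℕ → Bool
cycleEdge i u v =
  isEdge (3 * i) (3 * i + 3) u v ∨ isEdge (3 * i + 3) (3 * i + 2) u v ∨
  isEdge (3 * i + 2) (3 * i + 1) u v ∨ isEdge (3 * i + 1) (3 * i) u v

adjS : (n : ℕ) → Fin (nV n) → Fin (nV n) → Bool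
adjS n u v = any (λ i → cycleEdge i (toℕ u) (toℕ v)) (upTo n)

Graph : ℕ → Set
Graph m = Fin m → Fin m → Bool

VSet : ℕ → Set
VSet m = Vec Bool m

independent : ∀ {m} → Graph m → VSet m → Bool
independent {m} G S =
  Vec.foldr _ (λ u r → Vec.foldr _ (λ v r' → not (lookup S u ∧ lookup S v ∧ G u v) ∧ r') true (allFin m) ∧ r)
    true (allFin m)

maximalIndependent : ∀ {m} → Graph m → VSet m → Bool
maximalIndependent {m} G S =
  independent G S ∧
  Vec.foldr _ (λ v r → (lookup S v ∨ not (independent G (S [ v ]≔ true))) ∧ r) true (allFin m)

size : ∀ {m} → VSet m → ℕ
size = Vec.count (λ b → Data.Bool._≟_ b true)
  where import Data.Bool

allSubsets : (m : ℕ) → List (VSet m)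
allSubsets zero    = [] ∷ []
allSubsets (suc m) = map (true ∷_) (allSubsets m) ++ map (false ∷_) (allSubsets m)

s : ℕ → ℕ → ℕ
s n k = length (Data.List.filter (λ S → Data.Bool._≟_ (maximalIndependent (adjS n) S ∧ (size S ≡ᵇ k)) true)
                   (allSubsets (nV n)))
  where import Data.List; import Data.Bool

-- Formal power series in x,y over ℤ : coefficient of x^n y^k

PS : Set
PS = ℕ → ℕ → ℤ

sumTo : ℕ → (ℕ → ℤ) → ℤ
sumTo zero    f = f 0
sumTo (suc n) f = sumTo n f ℤ.+ f (suc n)

_⊛_ : PS → PS → PS
(f ⊛ g) n k = sumTo n (λ i → sumTo k (λ j → f i j ℤ.* g (n ∸ i) (k ∸ j)))

-- polynomial given as a list of monomials c·x^a·y^b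
poly : List (ℤ × ℕ × ℕ) → PS
poly ms n k = foldr (λ { (c , a , b) r → (if (a ≡ᵇ n) ∧ (b ≡ᵇ k) then c else + 0) ℤ.+ r }) (+ 0) ms

sGF : PS
sGF n k = + s n k

numer : PS
numer = poly ((+ 1 , 0 , 0) ∷ (ℤ.- (+ 2) , 1 , 1) ∷ (+ 2 , 1 , 2) ∷ (ℤ.- (+ 2) , 2 , 3)
              ∷ (+ 1 , 2 , 2) ∷ (+ 1 , 2 , 4) ∷ [])

denom : PS
denom = poly ((+ 1 , 0 , 0) ∷ (ℤ.- (+ 2) , 1 , 1) ∷ (+ 1 , 2 , 2) ∷ (ℤ.- (+ 1) , 2 , 3) ∷ [])

-- Read a vertex set of S(n) square by square: its restriction to a square must be
-- independent and must dominate the square's first three vertices, where the shared cut vertex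
-- may already be dominated from the previous square. Counting these bit strings by size with a
-- three-state transfer (the cut vertex is in the set / outside and dominated / outside and not
-- yet dominated) gives a linear recurrence whose characteristic polynomial is the denominator
-- 1 − 2xy + x²y² − x²y³; the numerator is what remains of the first few coefficients.
module Submission where

open import Defs
open import Function using (_∘_)
open import Relation.Binary.PropositionalEquality
  using (_≡_; _≢_; refl; sym; trans; cong; cong₂; subst; module ≡-Reasoning)
open import Relation.Nullary using (yes; no)
open import Data.Empty using (⊥; ⊥-elim)
open import Data.Product using (_×_; _,_; ∃; proj₁; proj₂)
open import Data.Sum using (_⊎_; inj₁; inj₂)
open import Data.Bool using (Bool; true; false; _∧_; _∨_; not; if_then_else_)
import Data.Bool as Bool
open import Data.Bool.Properties using (∧-zeroʳ; ∧-comm; ∨-comm)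
open import Data.Bool.ListAction using (any)
open import Data.Nat using (ℕ; zero; suc; _+_; _*_; _∸_; _≡ᵇ_; _≤ᵇ_; _<ᵇ_; _<_; _≤_; s≤s; z≤n)
open import Data.Nat.Properties using (+-identityʳ; +-comm; *-suc; ≤-pred)
open import Data.Nat.Tactic.RingSolver using (solve-∀)
open import Data.Fin using (Fin; toℕ)
import Data.Fin as Fin
open import Data.Fin.Properties using (toℕ-fromℕ<; toℕ<n)
open import Data.List using (List; []; _∷_; filter; length; map; _++_; applyUpTo; upTo)
open import Data.Vec using (Vec; []; _∷_; lookup; _[_]≔_; allFin)
import Data.Vec as Vec
open import Data.Vec.Properties using (lookup-allFin; lookup∘update; lookup∘update′)
open import Data.Integer using (ℤ; +_; 0ℤ; 1ℤ)
import Data.Integer as ℤ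
import Data.Integer.Properties as ℤ
import Data.Integer.Tactic.RingSolver as ℤ-Solver

∧-true⁻ : ∀ {a b} → a ∧ b ≡ true → a ≡ true × b ≡ true
∧-true⁻ {true} {true} _ = refl , refl

∧-true⁺ : ∀ {a b} → a ≡ true → b ≡ true → a ∧ b ≡ true
∧-true⁺ refl refl = refl

∨-true⁻ : ∀ {a b} → a ∨ b ≡ true → a ≡ true ⊎ b ≡ true
∨-true⁻ {true}  _ = inj₁ refl
∨-true⁻ {false} p = inj₂ p

∨-trueˡ : ∀ {a b} → a ≡ true → a ∨ b ≡ true
∨-trueˡ refl = refl

∨-trueʳ : ∀ {a b} → b ≡ true → a ∨ b ≡ true
∨-trueʳ {true}  _ = refl
∨-trueʳ {false} p = p

not-∧-true⁻ : ∀ {a b} → not (a ∧ b) ≡ true → a ≡ true → b ≡ true → ⊥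
not-∧-true⁻ {true} {true} ()

not-∧-true⁺ : ∀ {a b} → (a ≡ true → b ≡ true → ⊥) → not (a ∧ b) ≡ true
not-∧-true⁺ {true}  {true}  f = ⊥-elim (f refl refl)
not-∧-true⁺ {true}  {false} f = refl
not-∧-true⁺ {false}         f = refl

not-∧∧-true⁻ : ∀ {a b c} → not (a ∧ b ∧ c) ≡ true → a ≡ true → b ≡ true → c ≡ false
not-∧∧-true⁻ {true} {true} {false} _ _ _ = refl

not-∧∧-false⁻ : ∀ {a b c} → not (a ∧ b ∧ c) ≡ false → a ≡ true × b ≡ true × c ≡ true
not-∧∧-false⁻ {true} {true} {true} _ = refl , refl , refl

true≢false : true ≢ false
true≢false ()

≡true⇔⇒≡ : ∀ {a b : Bool} → (a ≡ true → b ≡ true) → (b ≡ true → a ≡ true) → a ≡ b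
≡true⇔⇒≡ {true}  {true}  f g = refl
≡true⇔⇒≡ {true}  {false} f g = sym (f refl)
≡true⇔⇒≡ {false} {true}  f g = g refl
≡true⇔⇒≡ {false} {false} f g = refl

allᶠ : ∀ {m} → (Fin m → Bool) → Bool
allᶠ {m} f = Vec.foldr (λ _ → Bool) (λ v r → f v ∧ r) true (allFin m)

module _ {m : ℕ} (f : Fin m → Bool) where

  private
    all : ∀ {k} → Vec (Fin m) k → Bool
    all = Vec.foldr (λ _ → Bool) (λ v r → f v ∧ r) true

    all-true⁻ : ∀ {k} (xs : Vec (Fin m) k) → all xs ≡ true → ∀ i → f (lookup xs i) ≡ true
    all-true⁻ (x ∷ xs) p Fin.zero    = proj₁ (∧-true⁻ p)
    all-true⁻ (x ∷ xs) p (Fin.suc i) = all-true⁻ xs (proj₂ (∧-true⁻ {f x} p)) i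

    all-true⁺ : ∀ {k} (xs : Vec (Fin m) k) → (∀ i → f (lookup xs i) ≡ true) → all xs ≡ true
    all-true⁺ []       p = refl
    all-true⁺ (x ∷ xs) p = ∧-true⁺ (p Fin.zero) (all-true⁺ xs (λ i → p (Fin.suc i)))

    all-false⁻ : ∀ {k} (xs : Vec (Fin m) k) → all xs ≡ false → ∃ λ i → f (lookup xs i) ≡ false
    all-false⁻ (x ∷ xs) p with f x in fx
    ... | true  = let i , q = all-false⁻ xs p in Fin.suc i , q
    ... | false = Fin.zero , fx

  allᶠ-true⁻ : allᶠ f ≡ true → ∀ v → f v ≡ true
  allᶠ-true⁻ p v = subst (λ w → f w ≡ true) (lookup-allFin v) (all-true⁻ (allFin m) p v)

  allᶠ-true⁺ : (∀ v → f v ≡ true) → allᶠ f ≡ true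
  allᶠ-true⁺ p = all-true⁺ (allFin m) (λ i → p (lookup (allFin m) i))

  allᶠ-false⁻ : allᶠ f ≡ false → ∃ λ v → f v ≡ false
  allᶠ-false⁻ p = let i , q = all-false⁻ (allFin m) p in lookup (allFin m) i , q

-- Maximal independent sets of an arbitrary graph

module _ {m : ℕ} (G : Graph m) where

  IndependentSet : VSet m → Set
  IndependentSet S = ∀ u v → lookup S u ≡ true → lookup S v ≡ true → G u v ≡ false

  Dominating : VSet m → Set
  Dominating S = ∀ v → lookup S v ≡ true ⊎ ∃ λ u → lookup S u ≡ true × G u v ≡ true

  independent-true⁻ : ∀ S → independent G S ≡ true → IndependentSet S
  independent-true⁻ S p u v = not-∧∧-true⁻ (allᶠ-true⁻ _ (allᶠ-true⁻ _ p u) v)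

  independent-true⁺ : ∀ S → IndependentSet S → independent G S ≡ true
  independent-true⁺ S I = allᶠ-true⁺ _ λ u → allᶠ-true⁺ _ λ v → pair u v
    where
    pair : ∀ u v → not (lookup S u ∧ lookup S v ∧ G u v) ≡ true
    pair u v with lookup S u in su | lookup S v in sv
    ... | false | _     = refl
    ... | true  | false = refl
    ... | true  | true  rewrite I u v su sv = refl

  independent-false⁻ : ∀ S → independent G S ≡ false →
                       ∃ λ u → ∃ λ v → lookup S u ≡ true × lookup S v ≡ true × G u v ≡ true
  independent-false⁻ S p =
    let u , pu = allᶠ-false⁻ _ p
        v , pv = allᶠ-false⁻ _ pu
    in u , v , not-∧∧-false⁻ pv

  module _ (G-sym : ∀ u v → G u v ≡ G v u) (G-irrefl : ∀ u → G u u ≡ false) where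

    insert-dependent⁻ : ∀ S {v} → IndependentSet S → independent G (S [ v ]≔ true) ≡ false →
                        ∃ λ u → lookup S u ≡ true × G u v ≡ true
    insert-dependent⁻ S {v} I p with independent-false⁻ (S [ v ]≔ true) p
    ... | u , w , pu , pw , g with u Fin.≟ v | w Fin.≟ v
    ... | yes refl | yes refl = ⊥-elim (true≢false (trans (sym g) (G-irrefl u)))
    ... | yes refl | no w≢v   = w , trans (sym (lookup∘update′ w≢v S true)) pw , trans (G-sym w u) g
    ... | no u≢v   | yes refl = u , trans (sym (lookup∘update′ u≢v S true)) pu , g
    ... | no u≢v   | no w≢v   = ⊥-elim (true≢false (trans (sym g)
            (I u w (trans (sym (lookup∘update′ u≢v S true)) pu)
                   (trans (sym (lookup∘update′ w≢v S true)) pw))))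

    maximalIndependent-true⁻ : ∀ S → maximalIndependent G S ≡ true → IndependentSet S × Dominating S
    maximalIndependent-true⁻ S p = I , D
      where
      I : IndependentSet S
      I = independent-true⁻ S (proj₁ (∧-true⁻ p))
      D : Dominating S
      D v with lookup S v | independent G (S [ v ]≔ true) in dep
             | allᶠ-true⁻ _ (proj₂ (∧-true⁻ {independent G S} p)) v
      ... | true  | _     | _  = inj₁ refl
      ... | false | false | _  = inj₂ (insert-dependent⁻ S I dep)
      ... | false | true  | ()

  insert-dependent⁺ : ∀ S {u v} → lookup S v ≡ false → lookup S u ≡ true → G u v ≡ true →
                      independent G (S [ v ]≔ true) ≡ false
  insert-dependent⁺ S {u} {v} sv su g with independent G (S [ v ]≔ true) in ind
  ... | false = refl
  ... | true  = ⊥-elim (true≢false (trans (sym g)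
                  (independent-true⁻ (S [ v ]≔ true) ind u v
                     (trans (lookup∘update′ u≢v S true) su) (lookup∘update v S true))))
    where
    u≢v : u ≢ v
    u≢v refl = true≢false (trans (sym su) sv)

  maximalIndependent-true⁺ : ∀ S → IndependentSet S → Dominating S → maximalIndependent G S ≡ true
  maximalIndependent-true⁺ S I D = ∧-true⁺ (independent-true⁺ S I) (allᶠ-true⁺ _ maximal)
    where
    maximal : ∀ v → (lookup S v ∨ not (independent G (S [ v ]≔ true))) ≡ true
    maximal v with lookup S v in sv | D v
    ... | true  | _                 = refl
    ... | false | inj₁ ()
    ... | false | inj₂ (u , su , g) = cong not (insert-dependent⁺ S sv su g)

countᵇ : {A : Set} → (A → Bool) → List A → ℕ
countᵇ p []       = 0
countᵇ p (x ∷ xs) = if p x then suc (countᵇ p xs) else countᵇ p xs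

length-filter≡countᵇ : {A : Set} (p : A → Bool) (xs : List A) →
                       length (filter (λ x → p x Bool.≟ true) xs) ≡ countᵇ p xs
length-filter≡countᵇ p []       = refl
length-filter≡countᵇ p (x ∷ xs) with p x
... | true  = cong suc (length-filter≡countᵇ p xs)
... | false = length-filter≡countᵇ p xs

countᵇ-++ : {A : Set} (p : A → Bool) (xs ys : List A) →
            countᵇ p (xs ++ ys) ≡ countᵇ p xs + countᵇ p ys
countᵇ-++ p []       ys = refl
countᵇ-++ p (x ∷ xs) ys with p x
... | true  = cong suc (countᵇ-++ p xs ys)
... | false = countᵇ-++ p xs ys

countᵇ-map : {A B : Set} (p : B → Bool) (f : A → B) (xs : List A) →
             countᵇ p (map f xs) ≡ countᵇ (p ∘ f) xs
countᵇ-map p f []       = refl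
countᵇ-map p f (x ∷ xs) rewrite countᵇ-map p f xs = refl

countᵇ-cong : {A : Set} {p q : A → Bool} → (∀ x → p x ≡ q x) → (xs : List A) →
              countᵇ p xs ≡ countᵇ q xs
countᵇ-cong p≗q []       = refl
countᵇ-cong p≗q (x ∷ xs) rewrite p≗q x | countᵇ-cong p≗q xs = refl

countᵇ-none : {A : Set} (xs : List A) → countᵇ (λ _ → false) xs ≡ 0
countᵇ-none []       = refl
countᵇ-none (x ∷ xs) = countᵇ-none xs

-- Multiplication of a sequence in k by y.
shift : (ℕ → ℕ) → ℕ → ℕ
shift f zero    = 0
shift f (suc k) = f k

shiftⁱ : ℕ → (ℕ → ℕ) → ℕ → ℕ
shiftⁱ zero    f = f
shiftⁱ (suc i) f = shift (shiftⁱ i f)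

shift-cong : {f g : ℕ → ℕ} → (∀ k → f k ≡ g k) → ∀ k → shift f k ≡ shift g k
shift-cong f≗g zero    = refl
shift-cong f≗g (suc k) = f≗g k

weightCount : (ℓ : ℕ) → (Vec Bool ℓ → Bool) → ℕ → ℕ
weightCount zero    Q zero    = if Q [] then 1 else 0
weightCount zero    Q (suc k) = 0
weightCount (suc ℓ) Q k       = shift (weightCount ℓ (Q ∘ (true ∷_))) k + weightCount ℓ (Q ∘ (false ∷_)) k

countᵇ-allSubsets : ∀ ℓ (Q : Vec Bool ℓ → Bool) k →
                    countᵇ (λ S → Q S ∧ (size S ≡ᵇ k)) (allSubsets ℓ) ≡ weightCount ℓ Q k
countᵇ-allSubsets zero Q zero with Q []
... | true  = refl
... | false = refl
countᵇ-allSubsets zero Q (suc k) with Q []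
... | true  = refl
... | false = refl
countᵇ-allSubsets (suc ℓ) Q k =
  trans (countᵇ-++ p (map (true ∷_) (allSubsets ℓ)) (map (false ∷_) (allSubsets ℓ)))
    (cong₂ _+_ (trans (countᵇ-map p (true ∷_) (allSubsets ℓ)) (withTrue k))
               (trans (countᵇ-map p (false ∷_) (allSubsets ℓ)) (countᵇ-allSubsets ℓ (Q ∘ (false ∷_)) k)))
  where
  p : Vec Bool (suc ℓ) → Bool
  p S = Q S ∧ (size S ≡ᵇ k)
  withTrue : ∀ k → countᵇ (λ S → Q (true ∷ S) ∧ (size (true ∷ S) ≡ᵇ k)) (allSubsets ℓ) ≡
                   shift (weightCount ℓ (Q ∘ (true ∷_))) k
  withTrue zero    =
    trans (countᵇ-cong (λ S → ∧-zeroʳ (Q (true ∷ S))) (allSubsets ℓ)) (countᵇ-none (allSubsets ℓ))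
  withTrue (suc k) = countᵇ-allSubsets ℓ (Q ∘ (true ∷_)) k

shiftⁱ-zero : {f : ℕ → ℕ} → (∀ k → f k ≡ 0) → ∀ i k → shiftⁱ i f k ≡ 0
shiftⁱ-zero f≗0 zero    k       = f≗0 k
shiftⁱ-zero f≗0 (suc i) zero    = refl
shiftⁱ-zero f≗0 (suc i) (suc k) = shiftⁱ-zero f≗0 i k

weightCount-none : ∀ ℓ k → weightCount ℓ (λ _ → false) k ≡ 0
weightCount-none zero    zero    = refl
weightCount-none zero    (suc k) = refl
weightCount-none (suc ℓ) k       = cong₂ _+_ (shiftⁱ-zero (weightCount-none ℓ) 1 k) (weightCount-none ℓ k)

weightCount-split₃ : ∀ ℓ (Q : Vec Bool (3 + ℓ) → Bool) k → weightCount (3 + ℓ) Q k ≡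
  ((shiftⁱ 3 (weightCount ℓ (λ r → Q (true ∷ true ∷ true ∷ r))) k
     + shiftⁱ 2 (weightCount ℓ (λ r → Q (true ∷ true ∷ false ∷ r))) k)
   + (shiftⁱ 2 (weightCount ℓ (λ r → Q (true ∷ false ∷ true ∷ r))) k
     + shiftⁱ 1 (weightCount ℓ (λ r → Q (true ∷ false ∷ false ∷ r))) k))
  + ((shiftⁱ 2 (weightCount ℓ (λ r → Q (false ∷ true ∷ true ∷ r))) k
     + shiftⁱ 1 (weightCount ℓ (λ r → Q (false ∷ true ∷ false ∷ r))) k)
   + (shiftⁱ 1 (weightCount ℓ (λ r → Q (false ∷ false ∷ true ∷ r))) k
     + shiftⁱ 0 (weightCount ℓ (λ r → Q (false ∷ false ∷ false ∷ r))) k))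
weightCount-split₃ ℓ Q zero                      = refl
weightCount-split₃ ℓ Q (suc zero)                = refl
weightCount-split₃ ℓ Q (suc (suc zero))          = refl
weightCount-split₃ ℓ Q (suc (suc (suc k)))       = refl

-- Bivariate power series

sumTo-cong : ∀ n {f g : ℕ → ℤ} → (∀ i → f i ≡ g i) → sumTo n f ≡ sumTo n g
sumTo-cong zero    f≗g = f≗g 0
sumTo-cong (suc n) f≗g = cong₂ ℤ._+_ (sumTo-cong n f≗g) (f≗g (suc n))

sumTo-zero : ∀ n {f : ℕ → ℤ} → (∀ i → f i ≡ 0ℤ) → sumTo n f ≡ 0ℤ
sumTo-zero zero    f≗0 = f≗0 0
sumTo-zero (suc n) f≗0 = cong₂ ℤ._+_ (sumTo-zero n f≗0) (f≗0 (suc n))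

sumTo-+ : ∀ n (f g : ℕ → ℤ) → sumTo n (λ i → f i ℤ.+ g i) ≡ sumTo n f ℤ.+ sumTo n g
sumTo-+ zero    f g = refl
sumTo-+ (suc n) f g =
  trans (cong (ℤ._+ (f (suc n) ℤ.+ g (suc n))) (sumTo-+ n f g))
        (interchange (sumTo n f) (sumTo n g) (f (suc n)) (g (suc n)))
  where
  interchange : ∀ a b c d → (a ℤ.+ b) ℤ.+ (c ℤ.+ d) ≡ (a ℤ.+ c) ℤ.+ (b ℤ.+ d)
  interchange = ℤ-Solver.solve-∀

sumTo-suc : ∀ n (f : ℕ → ℤ) → sumTo (suc n) f ≡ f 0 ℤ.+ sumTo n (f ∘ suc)
sumTo-suc zero    f = refl
sumTo-suc (suc n) f = trans (cong (ℤ._+ f (suc (suc n))) (sumTo-suc n f)) (ℤ.+-assoc (f 0) _ _)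

<ᵇ-suc : ∀ a n → (a <ᵇ suc n) ≡ (a ≤ᵇ n)
<ᵇ-suc zero    n = refl
<ᵇ-suc (suc a) n = refl

sumTo-point : ∀ n a (h : ℕ → ℤ) → sumTo n (λ i → if a ≡ᵇ i then h i else 0ℤ) ≡ (if a ≤ᵇ n then h a else 0ℤ)
sumTo-point zero    zero    h = refl
sumTo-point zero    (suc a) h = refl
sumTo-point (suc n) zero    h =
  trans (sumTo-suc n _) (trans (cong (ℤ._+_ (h 0)) (sumTo-zero n (λ _ → refl))) (ℤ.+-identityʳ (h 0)))
sumTo-point (suc n) (suc a) h = begin
  sumTo (suc n) (λ i → if suc a ≡ᵇ i then h i else 0ℤ)    ≡⟨ sumTo-suc n _ ⟩
  0ℤ ℤ.+ sumTo n (λ i → if a ≡ᵇ i then h (suc i) else 0ℤ) ≡⟨ ℤ.+-identityˡ _ ⟩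
  sumTo n (λ i → if a ≡ᵇ i then h (suc i) else 0ℤ)        ≡⟨ sumTo-point n a (h ∘ suc) ⟩
  (if a ≤ᵇ n then h (suc a) else 0ℤ)                      ≡˘⟨ cong (if_then h (suc a) else 0ℤ) (<ᵇ-suc a n) ⟩
  (if suc a ≤ᵇ suc n then h (suc a) else 0ℤ)              ∎
  where open ≡-Reasoning

⊛-congʳ : ∀ (f : PS) {g h : PS} → (∀ i j → g i j ≡ h i j) → ∀ n k → (f ⊛ g) n k ≡ (f ⊛ h) n k
⊛-congʳ f g≗h n k = sumTo-cong n (λ i → sumTo-cong k (λ j → cong (f i j ℤ.*_) (g≗h (n ∸ i) (k ∸ j))))

monomial : ℤ → ℕ → ℕ → PS
monomial c a b i j = if (a ≡ᵇ i) ∧ (b ≡ᵇ j) then c else 0ℤ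

monomial⊛ : ℤ → ℕ → ℕ → PS → PS
monomial⊛ c a b g n k = if a ≤ᵇ n then (if b ≤ᵇ k then c ℤ.* g (n ∸ a) (k ∸ b) else 0ℤ) else 0ℤ

poly⊛ : List (ℤ × ℕ × ℕ) → PS → PS
poly⊛ []                  g n k = 0ℤ
poly⊛ ((c , a , b) ∷ ms) g n k = monomial⊛ c a b g n k ℤ.+ poly⊛ ms g n k

⊛-distribʳ-+ : ∀ (f h g : PS) n k → ((λ i j → f i j ℤ.+ h i j) ⊛ g) n k ≡ (f ⊛ g) n k ℤ.+ (h ⊛ g) n k
⊛-distribʳ-+ f h g n k = begin
  sumTo n (λ i → sumTo k (λ j → (f i j ℤ.+ h i j) ℤ.* g (n ∸ i) (k ∸ j)))
    ≡⟨ sumTo-cong n (λ i → sumTo-cong k (λ j → ℤ.*-distribʳ-+ (g (n ∸ i) (k ∸ j)) (f i j) (h i j))) ⟩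
  sumTo n (λ i → sumTo k (λ j → f i j ℤ.* g (n ∸ i) (k ∸ j) ℤ.+ h i j ℤ.* g (n ∸ i) (k ∸ j)))
    ≡⟨ sumTo-cong n (λ i → sumTo-+ k _ _) ⟩
  sumTo n (λ i → sumTo k (λ j → f i j ℤ.* g (n ∸ i) (k ∸ j)) ℤ.+ sumTo k (λ j → h i j ℤ.* g (n ∸ i) (k ∸ j)))
    ≡⟨ sumTo-+ n _ _ ⟩
  (f ⊛ g) n k ℤ.+ (h ⊛ g) n k ∎
  where open ≡-Reasoning

monomial-⊛ : ∀ c a b g n k → (monomial c a b ⊛ g) n k ≡ monomial⊛ c a b g n k
monomial-⊛ c a b g n k = trans (sumTo-cong n row) (sumTo-point n a _)
  where
  row : ∀ i → sumTo k (λ j → monomial c a b i j ℤ.* g (n ∸ i) (k ∸ j))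
            ≡ (if a ≡ᵇ i then (if b ≤ᵇ k then c ℤ.* g (n ∸ i) (k ∸ b) else 0ℤ) else 0ℤ)
  row i with a ≡ᵇ i
  ... | false = sumTo-zero k (λ _ → refl)
  ... | true  = trans (sumTo-cong k entry) (sumTo-point k b (λ j → c ℤ.* g (n ∸ i) (k ∸ j)))
    where
    entry : ∀ j → (if b ≡ᵇ j then c else 0ℤ) ℤ.* g (n ∸ i) (k ∸ j)
                ≡ (if b ≡ᵇ j then c ℤ.* g (n ∸ i) (k ∸ j) else 0ℤ)
    entry j with b ≡ᵇ j
    ... | true  = refl
    ... | false = refl

poly-⊛ : ∀ ms g n k → (poly ms ⊛ g) n k ≡ poly⊛ ms g n k
poly-⊛ []                  g n k = sumTo-zero n (λ _ → sumTo-zero k (λ _ → refl))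
poly-⊛ ((c , a , b) ∷ ms) g n k =
  trans (⊛-distribʳ-+ (monomial c a b) (poly ms) g n k)
        (cong₂ ℤ._+_ (monomial-⊛ c a b g n k) (poly-⊛ ms g n k))

any-applyUpTo : ∀ (g : ℕ → Bool) f m → any g (applyUpTo f m) ≡ any (g ∘ f) (upTo m)
any-applyUpTo g f zero    = refl
any-applyUpTo g f (suc m) = cong (g (f 0) ∨_)
  (trans (any-applyUpTo g (f ∘ suc) m) (sym (any-applyUpTo (g ∘ f) suc m)))

any-cong : ∀ {A : Set} {g h : A → Bool} → (∀ x → g x ≡ h x) → ∀ xs → any g xs ≡ any h xs
any-cong g≗h []       = refl
any-cong g≗h (x ∷ xs) = cong₂ _∨_ (g≗h x) (any-cong g≗h xs)

any-false : ∀ {A : Set} {g : A → Bool} → (∀ x → g x ≡ false) → ∀ xs → any g xs ≡ false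
any-false g≗false []       = refl
any-false g≗false (x ∷ xs) rewrite g≗false x = any-false g≗false xs

isEdge-sym : ∀ a b u v → isEdge a b u v ≡ isEdge a b v u
isEdge-sym a b u v =
  trans (∨-comm ((u ≡ᵇ a) ∧ (v ≡ᵇ b)) _) (cong₂ _∨_ (∧-comm (u ≡ᵇ b) _) (∧-comm (u ≡ᵇ a) _))

cycleEdge-sym : ∀ i u v → cycleEdge i u v ≡ cycleEdge i v u
cycleEdge-sym i u v = cong₂ _∨_ (isEdge-sym _ _ u v)
  (cong₂ _∨_ (isEdge-sym _ _ u v) (cong₂ _∨_ (isEdge-sym _ _ u v) (isEdge-sym _ _ u v)))

-- cycleEdge i is definitionally squareFrom (3 * i).
squareFrom : ℕ → ℕ → ℕ → Bool
squareFrom b u v =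
  isEdge b (b + 3) u v ∨ isEdge (b + 3) (b + 2) u v ∨ isEdge (b + 2) (b + 1) u v ∨ isEdge (b + 1) b u v

cycleEdge-suc : ∀ i u v → cycleEdge (suc i) u v ≡ squareFrom (3 + 3 * i) u v
cycleEdge-suc i u v = cong (λ b → squareFrom b u v) (*-suc 3 i)

cycleEdge-suc-shift : ∀ i u v → cycleEdge (suc i) (3 + u) (3 + v) ≡ cycleEdge i u v
cycleEdge-suc-shift i u v = cycleEdge-suc i (3 + u) (3 + v)

cycleEdge-suc-low : ∀ i u v → u < 3 → cycleEdge (suc i) u v ≡ false
cycleEdge-suc-low i 0 v _ = cycleEdge-suc i 0 v
cycleEdge-suc-low i 1 v _ = cycleEdge-suc i 1 v
cycleEdge-suc-low i 2 v _ = cycleEdge-suc i 2 v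
cycleEdge-suc-low i (suc (suc (suc u))) v (s≤s (s≤s (s≤s ())))

cycleEdge-suc-lowʳ : ∀ i u v → v < 3 → cycleEdge (suc i) u v ≡ false
cycleEdge-suc-lowʳ i u v v<3 = trans (cycleEdge-sym (suc i) u v) (cycleEdge-suc-low i v u v<3)

-- The edges of the first square, with the pairs of vertices ≥ 3 excluded by a separate clause
-- so that they reduce to false; the other pairs are read off from cycleEdge 0.
squareEdge : ℕ → ℕ → Bool
squareEdge (suc (suc (suc u))) (suc (suc (suc v))) = false
squareEdge u v                                     = cycleEdge 0 u v

cactusAdj laterAdj : ℕ → ℕ → ℕ → Bool
cactusAdj zero    u v = false
cactusAdj (suc m) u v = squareEdge u v ∨ laterAdj m u v
laterAdj m (suc (suc (suc u))) (suc (suc (suc v))) = cactusAdj m u v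
laterAdj m u                   v                   = false

cycleEdge-zero : ∀ u v → cycleEdge 0 u v ≡ squareEdge u v
cycleEdge-zero 0 v = refl
cycleEdge-zero 1 v = refl
cycleEdge-zero 2 v = refl
cycleEdge-zero (suc (suc (suc u))) 0 = refl
cycleEdge-zero (suc (suc (suc u))) 1 = refl
cycleEdge-zero (suc (suc (suc u))) 2 = refl
cycleEdge-zero (suc (suc (suc zero)))    (suc (suc (suc v))) = refl
cycleEdge-zero (suc (suc (suc (suc u)))) (suc (suc (suc v))) = refl

anyCycleEdge : ℕ → ℕ → ℕ → Bool
anyCycleEdge m u v = any (λ i → cycleEdge i u v) (upTo m)

anyCycleEdge≡cactusAdj : ∀ m u v → anyCycleEdge m u v ≡ cactusAdj m u v
anyLaterEdge≡laterAdj  : ∀ m u v → any (λ i → cycleEdge (suc i) u v) (upTo m) ≡ laterAdj m u v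
anyCycleEdge≡cactusAdj zero    u v = refl
anyCycleEdge≡cactusAdj (suc m) u v = cong₂ _∨_ (cycleEdge-zero u v)
  (trans (any-applyUpTo (λ i → cycleEdge i u v) suc m) (anyLaterEdge≡laterAdj m u v))
anyLaterEdge≡laterAdj m 0 v = any-false (λ i → cycleEdge-suc-low i 0 v (s≤s z≤n)) (upTo m)
anyLaterEdge≡laterAdj m 1 v = any-false (λ i → cycleEdge-suc-low i 1 v (s≤s (s≤s z≤n))) (upTo m)
anyLaterEdge≡laterAdj m 2 v = any-false (λ i → cycleEdge-suc-low i 2 v (s≤s (s≤s (s≤s z≤n)))) (upTo m)
anyLaterEdge≡laterAdj m (suc (suc (suc u))) 0 =
  any-false (λ i → cycleEdge-suc-lowʳ i (3 + u) 0 (s≤s z≤n)) (upTo m)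
anyLaterEdge≡laterAdj m (suc (suc (suc u))) 1 =
  any-false (λ i → cycleEdge-suc-lowʳ i (3 + u) 1 (s≤s (s≤s z≤n))) (upTo m)
anyLaterEdge≡laterAdj m (suc (suc (suc u))) 2 =
  any-false (λ i → cycleEdge-suc-lowʳ i (3 + u) 2 (s≤s (s≤s (s≤s z≤n)))) (upTo m)
anyLaterEdge≡laterAdj m (suc (suc (suc u))) (suc (suc (suc v))) =
  trans (any-cong (λ i → cycleEdge-suc-shift i u v) (upTo m)) (anyCycleEdge≡cactusAdj m u v)

cactusAdj-sym : ∀ m u v → cactusAdj m u v ≡ cactusAdj m v u
cactusAdj-sym m u v = begin
  cactusAdj m u v    ≡˘⟨ anyCycleEdge≡cactusAdj m u v ⟩
  anyCycleEdge m u v ≡⟨ any-cong (λ i → cycleEdge-sym i u v) (upTo m) ⟩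
  anyCycleEdge m v u ≡⟨ anyCycleEdge≡cactusAdj m v u ⟩
  cactusAdj m v u    ∎
  where open ≡-Reasoning

cactusAdj-irrefl : ∀ m u → cactusAdj m u u ≡ false
cactusAdj-irrefl zero    u                   = refl
cactusAdj-irrefl (suc m) 0                   = refl
cactusAdj-irrefl (suc m) 1                   = refl
cactusAdj-irrefl (suc m) 2                   = refl
cactusAdj-irrefl (suc m) (suc (suc (suc u))) = cactusAdj-irrefl m u

-- Maximal independent sets of S(n) as accepted bit strings

triple : ℕ → ℕ
triple zero    = 0
triple (suc n) = 3 + triple n

squareIndependent : Bool → Bool → Bool → Bool → Bool
squareIndependent t₀ t₁ t₂ t₃ = not (t₀ ∧ t₁) ∧ not (t₁ ∧ t₂) ∧ not (t₂ ∧ t₃) ∧ not (t₃ ∧ t₀)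

squareDominated : Bool → Bool → Bool → Bool → Bool → Bool
squareDominated d t₀ t₁ t₂ t₃ = (t₀ ∨ d ∨ t₁ ∨ t₃) ∧ (t₁ ∨ t₀ ∨ t₂) ∧ (t₂ ∨ t₁ ∨ t₃)

-- chainOK d (t₀ ∷ …) reads the bits of the vertices 0, 1, 2, 3, …; d says whether vertex 0 is
-- already dominated from outside, and the next cut vertex 3 is dominated from its left square iff
-- t₀ or t₂ is set. Lengths other than 1 + 3m are rejected.
chainOK : ∀ {ℓ} → Bool → Vec Bool ℓ → Bool
chainOK d []                         = false
chainOK d (t₀ ∷ [])                  = t₀ ∨ d
chainOK d (t₀ ∷ t₁ ∷ [])             = false
chainOK d (t₀ ∷ t₁ ∷ t₂ ∷ [])        = false
chainOK d (t₀ ∷ t₁ ∷ t₂ ∷ t₃ ∷ r)    =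
  (squareIndependent t₀ t₁ t₂ t₃ ∧ squareDominated d t₀ t₁ t₂ t₃) ∧ chainOK (t₀ ∨ t₂) (t₃ ∷ r)

drop₃ : (ℕ → Bool) → ℕ → Bool
drop₃ T i = T (3 + i)

chainOKᶠ : ℕ → Bool → (ℕ → Bool) → Bool
chainOKᶠ zero    d T = T 0 ∨ d
chainOKᶠ (suc m) d T =
  (squareIndependent (T 0) (T 1) (T 2) (T 3) ∧ squareDominated d (T 0) (T 1) (T 2) (T 3))
  ∧ chainOKᶠ m (T 0 ∨ T 2) (drop₃ T)

Independent : ℕ → (ℕ → Bool) → Set
Independent m T = ∀ u v → T u ≡ true → T v ≡ true → cactusAdj m u v ≡ false

DominatedAt : ℕ → Bool → (ℕ → Bool) → ℕ → Set
DominatedAt m d T v = T v ≡ true ⊎ (v ≡ 0 × d ≡ true) ⊎ ∃ λ u → T u ≡ true × cactusAdj m u v ≡ true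

Dominated : ℕ → Bool → (ℕ → Bool) → Set
Dominated m d T = ∀ v → v ≤ triple m → DominatedAt m d T v

independent-∷ : ∀ {m T} → squareIndependent (T 0) (T 1) (T 2) (T 3) ≡ true →
                Independent m (drop₃ T) → Independent (suc m) T
independent-∷ {m} {T} sq I = edgeFree
  where
  n₁₂₃ : (not (T 1 ∧ T 2) ∧ not (T 2 ∧ T 3) ∧ not (T 3 ∧ T 0)) ≡ true
  n₁₂₃ = proj₂ (∧-true⁻ {not (T 0 ∧ T 1)} sq)
  n₂₃ : (not (T 2 ∧ T 3) ∧ not (T 3 ∧ T 0)) ≡ true
  n₂₃ = proj₂ (∧-true⁻ {not (T 1 ∧ T 2)} n₁₂₃)
  c₀₁ : T 0 ≡ true → T 1 ≡ true → ⊥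
  c₀₁ = not-∧-true⁻ (proj₁ (∧-true⁻ sq))
  c₁₂ : T 1 ≡ true → T 2 ≡ true → ⊥
  c₁₂ = not-∧-true⁻ (proj₁ (∧-true⁻ n₁₂₃))
  c₂₃ : T 2 ≡ true → T 3 ≡ true → ⊥
  c₂₃ = not-∧-true⁻ (proj₁ (∧-true⁻ n₂₃))
  c₃₀ : T 3 ≡ true → T 0 ≡ true → ⊥
  c₃₀ = not-∧-true⁻ (proj₂ (∧-true⁻ {not (T 2 ∧ T 3)} n₂₃))
  edgeFree : Independent (suc m) T
  edgeFree 0 0 tu tv = refl
  edgeFree 0 1 tu tv = ⊥-elim (c₀₁ tu tv)
  edgeFree 0 2 tu tv = refl
  edgeFree 0 3 tu tv = ⊥-elim (c₃₀ tv tu)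
  edgeFree 0 (suc (suc (suc (suc v)))) tu tv = refl
  edgeFree 1 0 tu tv = ⊥-elim (c₀₁ tv tu)
  edgeFree 1 1 tu tv = refl
  edgeFree 1 2 tu tv = ⊥-elim (c₁₂ tu tv)
  edgeFree 1 (suc (suc (suc v))) tu tv = refl
  edgeFree 2 0 tu tv = refl
  edgeFree 2 1 tu tv = ⊥-elim (c₁₂ tv tu)
  edgeFree 2 2 tu tv = refl
  edgeFree 2 3 tu tv = ⊥-elim (c₂₃ tu tv)
  edgeFree 2 (suc (suc (suc (suc v)))) tu tv = refl
  edgeFree 3 0 tu tv = ⊥-elim (c₃₀ tu tv)
  edgeFree 3 1 tu tv = refl
  edgeFree 3 2 tu tv = ⊥-elim (c₂₃ tv tu)
  edgeFree (suc (suc (suc (suc u)))) 0 tu tv = refl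
  edgeFree (suc (suc (suc (suc u)))) 1 tu tv = refl
  edgeFree (suc (suc (suc (suc u)))) 2 tu tv = refl
  edgeFree (suc (suc (suc u))) (suc (suc (suc v))) tu tv = I u v tu tv

independent-∷⁻ : ∀ {m T} → Independent (suc m) T →
                 squareIndependent (T 0) (T 1) (T 2) (T 3) ≡ true × Independent m (drop₃ T)
independent-∷⁻ {m} {T} I = square , λ u v → I (3 + u) (3 + v)
  where
  apart : ∀ u v → cactusAdj (suc m) u v ≡ true → not (T u ∧ T v) ≡ true
  apart u v uv = not-∧-true⁺ λ tu tv → true≢false (trans (sym uv) (I u v tu tv))
  square : squareIndependent (T 0) (T 1) (T 2) (T 3) ≡ true
  square = ∧-true⁺ (apart 0 1 refl) (∧-true⁺ (apart 1 2 refl) (∧-true⁺ (apart 2 3 refl) (apart 3 0 refl)))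

dominated-∷ : ∀ {m d T} → squareDominated d (T 0) (T 1) (T 2) (T 3) ≡ true →
              Dominated m (T 0 ∨ T 2) (drop₃ T) → Dominated (suc m) d T
dominated-∷ {m} {d} {T} sq D = dominated
  where
  d₀ : (T 0 ∨ d ∨ T 1 ∨ T 3) ≡ true
  d₀ = proj₁ (∧-true⁻ sq)
  d₁ : (T 1 ∨ T 0 ∨ T 2) ≡ true
  d₁ = proj₁ (∧-true⁻ (proj₂ (∧-true⁻ {T 0 ∨ d ∨ T 1 ∨ T 3} sq)))
  d₂ : (T 2 ∨ T 1 ∨ T 3) ≡ true
  d₂ = proj₂ (∧-true⁻ {T 1 ∨ T 0 ∨ T 2} (proj₂ (∧-true⁻ {T 0 ∨ d ∨ T 1 ∨ T 3} sq)))
  by : ∀ u {v} → T u ≡ true → cactusAdj (suc m) u v ≡ true → DominatedAt (suc m) d T v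
  by u tu uv = inj₂ (inj₂ (u , tu , uv))
  dominated : Dominated (suc m) d T
  dominated 0 _ with ∨-true⁻ {T 0} d₀
  ... | inj₁ t₀ = inj₁ t₀
  ... | inj₂ p with ∨-true⁻ {d} p
  ... | inj₁ d≡true = inj₂ (inj₁ (refl , d≡true))
  ... | inj₂ q with ∨-true⁻ {T 1} q
  ... | inj₁ t₁ = by 1 t₁ refl
  ... | inj₂ t₃ = by 3 t₃ refl
  dominated 1 _ with ∨-true⁻ {T 1} d₁
  ... | inj₁ t₁ = inj₁ t₁
  ... | inj₂ p with ∨-true⁻ {T 0} p
  ... | inj₁ t₀ = by 0 t₀ refl
  ... | inj₂ t₂ = by 2 t₂ refl
  dominated 2 _ with ∨-true⁻ {T 2} d₂
  ... | inj₁ t₂ = inj₁ t₂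
  ... | inj₂ p with ∨-true⁻ {T 1} p
  ... | inj₁ t₁ = by 1 t₁ refl
  ... | inj₂ t₃ = by 3 t₃ refl
  dominated (suc (suc (suc w))) (s≤s (s≤s (s≤s w≤))) with D w w≤
  ... | inj₁ t = inj₁ t
  ... | inj₂ (inj₂ (u , tu , uw)) = by (3 + u) tu uw
  ... | inj₂ (inj₁ (refl , p)) with ∨-true⁻ {T 0} p
  ... | inj₁ t₀ = by 0 t₀ refl
  ... | inj₂ t₂ = by 2 t₂ refl

dominated⇒squareDominated : ∀ {m d T} → Dominated (suc m) d T →
                            squareDominated d (T 0) (T 1) (T 2) (T 3) ≡ true
dominated⇒squareDominated {m} {d} {T} D = ∧-true⁺ d₀ (∧-true⁺ d₁ d₂)
  where
  d₀ : (T 0 ∨ d ∨ T 1 ∨ T 3) ≡ true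
  d₀ with D 0 z≤n
  ... | inj₁ t₀                        = ∨-trueˡ t₀
  ... | inj₂ (inj₁ (_ , d≡true))       = ∨-trueʳ {T 0} (∨-trueˡ d≡true)
  ... | inj₂ (inj₂ (1 , t₁ , _))       = ∨-trueʳ {T 0} (∨-trueʳ {d} (∨-trueˡ t₁))
  ... | inj₂ (inj₂ (3 , t₃ , _))       = ∨-trueʳ {T 0} (∨-trueʳ {d} (∨-trueʳ {T 1} t₃))
  ... | inj₂ (inj₂ (0 , _ , ()))
  ... | inj₂ (inj₂ (2 , _ , ()))
  ... | inj₂ (inj₂ (suc (suc (suc (suc u))) , _ , ()))
  d₁ : (T 1 ∨ T 0 ∨ T 2) ≡ true
  d₁ with D 1 (s≤s z≤n)
  ... | inj₁ t₁                        = ∨-trueˡ t₁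
  ... | inj₂ (inj₁ (() , _))
  ... | inj₂ (inj₂ (0 , t₀ , _))       = ∨-trueʳ {T 1} (∨-trueˡ t₀)
  ... | inj₂ (inj₂ (2 , t₂ , _))       = ∨-trueʳ {T 1} (∨-trueʳ {T 0} t₂)
  ... | inj₂ (inj₂ (1 , _ , ()))
  ... | inj₂ (inj₂ (3 , _ , ()))
  ... | inj₂ (inj₂ (suc (suc (suc (suc u))) , _ , ()))
  d₂ : (T 2 ∨ T 1 ∨ T 3) ≡ true
  d₂ with D 2 (s≤s (s≤s z≤n))
  ... | inj₁ t₂                        = ∨-trueˡ t₂
  ... | inj₂ (inj₁ (() , _))
  ... | inj₂ (inj₂ (1 , t₁ , _))       = ∨-trueʳ {T 2} (∨-trueˡ t₁)
  ... | inj₂ (inj₂ (3 , t₃ , _))       = ∨-trueʳ {T 2} (∨-trueʳ {T 1} t₃)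
  ... | inj₂ (inj₂ (0 , _ , ()))
  ... | inj₂ (inj₂ (2 , _ , ()))
  ... | inj₂ (inj₂ (suc (suc (suc (suc u))) , _ , ()))

dominated-drop₃ : ∀ {m d T} → Dominated (suc m) d T → Dominated m (T 0 ∨ T 2) (drop₃ T)
dominated-drop₃ {m} {d} {T} D w w≤ with D (3 + w) (s≤s (s≤s (s≤s w≤)))
... | inj₁ t                                   = inj₁ t
... | inj₂ (inj₁ (() , _))
... | inj₂ (inj₂ (suc (suc (suc u)) , tu , uw)) = inj₂ (inj₂ (u , tu , uw))
dominated-drop₃ {m} {d} {T} D 0 w≤ | inj₂ (inj₂ (0 , t₀ , _)) = inj₂ (inj₁ (refl , ∨-trueˡ t₀))
dominated-drop₃ {m} {d} {T} D 0 w≤ | inj₂ (inj₂ (2 , t₂ , _)) = inj₂ (inj₁ (refl , ∨-trueʳ {T 0} t₂))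
dominated-drop₃ D (suc w) w≤ | inj₂ (inj₂ (0 , _ , ()))
dominated-drop₃ D (suc w) w≤ | inj₂ (inj₂ (2 , _ , ()))
dominated-drop₃ D w       w≤ | inj₂ (inj₂ (1 , _ , ()))

chainOKᶠ-true⁻ : ∀ m d T → chainOKᶠ m d T ≡ true → Independent m T × Dominated m d T
chainOKᶠ-true⁻ zero d T p = (λ _ _ _ _ → refl) , dominated
  where
  dominated : Dominated 0 d T
  dominated zero z≤n with ∨-true⁻ {T 0} p
  ... | inj₁ t₀     = inj₁ t₀
  ... | inj₂ d≡true = inj₂ (inj₁ (refl , d≡true))
chainOKᶠ-true⁻ (suc m) d T p =
  independent-∷ (proj₁ square) (proj₁ rest) , dominated-∷ (proj₂ square) (proj₂ rest)
  where
  sqI sqD : Bool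
  sqI = squareIndependent (T 0) (T 1) (T 2) (T 3)
  sqD = squareDominated d (T 0) (T 1) (T 2) (T 3)
  square : sqI ≡ true × sqD ≡ true
  square = ∧-true⁻ (proj₁ (∧-true⁻ {sqI ∧ sqD} p))
  rest : Independent m (drop₃ T) × Dominated m (T 0 ∨ T 2) (drop₃ T)
  rest = chainOKᶠ-true⁻ m (T 0 ∨ T 2) (drop₃ T) (proj₂ (∧-true⁻ {sqI ∧ sqD} p))

chainOKᶠ-true⁺ : ∀ m d T → Independent m T → Dominated m d T → chainOKᶠ m d T ≡ true
chainOKᶠ-true⁺ zero d T I D with D 0 z≤n
... | inj₁ t₀                      = ∨-trueˡ t₀
... | inj₂ (inj₁ (_ , d≡true))     = ∨-trueʳ {T 0} d≡true
... | inj₂ (inj₂ (u , _ , ()))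
chainOKᶠ-true⁺ (suc m) d T I D =
  ∧-true⁺ (∧-true⁺ (proj₁ (independent-∷⁻ I)) (dominated⇒squareDominated D))
          (chainOKᶠ-true⁺ m (T 0 ∨ T 2) (drop₃ T) (proj₂ (independent-∷⁻ I)) (dominated-drop₃ D))

bitAt : ∀ {m} → Vec Bool m → ℕ → Bool
bitAt []      v       = false
bitAt (x ∷ S) zero    = x
bitAt (x ∷ S) (suc v) = bitAt S v

lookup≡bitAt : ∀ {m} (S : Vec Bool m) (u : Fin m) → lookup S u ≡ bitAt S (toℕ u)
lookup≡bitAt (x ∷ S) Fin.zero    = refl
lookup≡bitAt (x ∷ S) (Fin.suc u) = lookup≡bitAt S u

bitAt-true⇒< : ∀ {m} (S : Vec Bool m) v → bitAt S v ≡ true → v < m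
bitAt-true⇒< (x ∷ S) zero    _ = s≤s z≤n
bitAt-true⇒< (x ∷ S) (suc v) p = s≤s (bitAt-true⇒< S v p)

chainOK≡chainOKᶠ : ∀ m d {ℓ} → ℓ ≡ suc (triple m) → (S : Vec Bool ℓ) → chainOK d S ≡ chainOKᶠ m d (bitAt S)
chainOK≡chainOKᶠ zero    d refl (t₀ ∷ [])              = refl
chainOK≡chainOKᶠ (suc m) d refl (t₀ ∷ t₁ ∷ t₂ ∷ t₃ ∷ r) =
  cong (_ ∧_) (chainOK≡chainOKᶠ m (t₀ ∨ t₂) refl (t₃ ∷ r))

triple≡3* : ∀ n → triple n ≡ 3 * n
triple≡3* zero    = refl
triple≡3* (suc n) = trans (cong (_+_ 3) (triple≡3* n)) (sym (*-suc 3 n))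

nV-suc : ∀ n → nV (suc n) ≡ suc (triple (suc n))
nV-suc n = trans (+-comm (3 * n) 4) (cong (_+_ 4) (sym (triple≡3* n)))

module Cactus (n : ℕ) where

  m : ℕ
  m = nV (suc n)

  vertex : ∀ v → v < m → ∃ λ (u : Fin m) → toℕ u ≡ v
  vertex v v<m = Fin.fromℕ< v<m , toℕ-fromℕ< v<m

  vertex-≤ : ∀ (u : Fin m) → toℕ u ≤ triple (suc n)
  vertex-≤ u = ≤-pred (subst (toℕ u <_) (nV-suc n) (toℕ<n u))

  adjS≡cactusAdj : ∀ u v → adjS (suc n) u v ≡ cactusAdj (suc n) (toℕ u) (toℕ v)
  adjS≡cactusAdj u v = anyCycleEdge≡cactusAdj (suc n) (toℕ u) (toℕ v)

  G-sym : ∀ u v → adjS (suc n) u v ≡ adjS (suc n) v u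
  G-sym u v = trans (adjS≡cactusAdj u v)
    (trans (cactusAdj-sym (suc n) (toℕ u) (toℕ v)) (sym (adjS≡cactusAdj v u)))

  G-irrefl : ∀ u → adjS (suc n) u u ≡ false
  G-irrefl u = trans (adjS≡cactusAdj u u) (cactusAdj-irrefl (suc n) (toℕ u))

  module _ (S : VSet m) where

    independentSet⇒ : IndependentSet (adjS (suc n)) S → Independent (suc n) (bitAt S)
    independentSet⇒ I u v tu tv with vertex u (bitAt-true⇒< S u tu) | vertex v (bitAt-true⇒< S v tv)
    ... | u′ , refl | v′ , refl =
      trans (sym (adjS≡cactusAdj u′ v′)) (I u′ v′ (trans (lookup≡bitAt S u′) tu) (trans (lookup≡bitAt S v′) tv))

    independentSet⇐ : Independent (suc n) (bitAt S) → IndependentSet (adjS (suc n)) S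
    independentSet⇐ I u v su sv = trans (adjS≡cactusAdj u v)
      (I (toℕ u) (toℕ v) (trans (sym (lookup≡bitAt S u)) su) (trans (sym (lookup≡bitAt S v)) sv))

    dominating⇒ : Dominating (adjS (suc n)) S → Dominated (suc n) false (bitAt S)
    dominating⇒ D v v≤ with vertex v (subst (v <_) (sym (nV-suc n)) (s≤s v≤))
    ... | v′ , refl with D v′
    ... | inj₁ sv              = inj₁ (trans (sym (lookup≡bitAt S v′)) sv)
    ... | inj₂ (u , su , uv)   =
      inj₂ (inj₂ (toℕ u , trans (sym (lookup≡bitAt S u)) su , trans (sym (adjS≡cactusAdj u v′)) uv))

    dominating⇐ : Dominated (suc n) false (bitAt S) → Dominating (adjS (suc n)) S
    dominating⇐ D v with D (toℕ v) (vertex-≤ v)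
    ... | inj₁ t                    = inj₁ (trans (lookup≡bitAt S v) t)
    ... | inj₂ (inj₁ (_ , ()))
    ... | inj₂ (inj₂ (u , tu , uv)) with vertex u (bitAt-true⇒< S u tu)
    ... | u′ , refl = inj₂ (u′ , trans (lookup≡bitAt S u′) tu , trans (adjS≡cactusAdj u′ v) uv)

    maximalIndependent≡chainOK : maximalIndependent (adjS (suc n)) S ≡ chainOK false S
    maximalIndependent≡chainOK =
      trans (≡true⇔⇒≡ sound complete) (sym (chainOK≡chainOKᶠ (suc n) false (nV-suc n) S))
      where
      sound : maximalIndependent (adjS (suc n)) S ≡ true → chainOKᶠ (suc n) false (bitAt S) ≡ true
      sound p = let I , D = maximalIndependent-true⁻ (adjS (suc n)) G-sym G-irrefl S p in
        chainOKᶠ-true⁺ (suc n) false (bitAt S) (independentSet⇒ I) (dominating⇒ D)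
      complete : chainOKᶠ (suc n) false (bitAt S) ≡ true → maximalIndependent (adjS (suc n)) S ≡ true
      complete p = let I , D = chainOKᶠ-true⁻ (suc n) false (bitAt S) p in
        maximalIndependent-true⁺ (adjS (suc n)) S (independentSet⇐ I) (dominating⇐ D)

-- The transfer recurrences

-- For a chain of n squares whose first cut vertex is in the set, outside but already dominated,
-- or outside and not yet dominated: the number of accepted bit strings of the other 3n vertices
-- with k letters true.
#in #covered #open : ℕ → ℕ → ℕ
#in      n = weightCount (triple n) (λ r → chainOK false (true ∷ r))
#covered n = weightCount (triple n) (λ r → chainOK true (false ∷ r))
#open    n = weightCount (triple n) (λ r → chainOK false (false ∷ r))

+₈-cong : ∀ {a b c d e f g h a′ b′ c′ d′ e′ f′ g′ h′ : ℕ} →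
  a ≡ a′ → b ≡ b′ → c ≡ c′ → d ≡ d′ → e ≡ e′ → f ≡ f′ → g ≡ g′ → h ≡ h′ →
  ((a + b) + (c + d)) + ((e + f) + (g + h)) ≡ ((a′ + b′) + (c′ + d′)) + ((e′ + f′) + (g′ + h′))
+₈-cong refl refl refl refl refl refl refl refl = refl

module _ (n : ℕ) (k : ℕ) where

  private
    none : ∀ i → shiftⁱ i (weightCount (triple n) (λ _ → false)) k ≡ 0
    none i = shiftⁱ-zero (weightCount-none (triple n)) i k

  #in-suc : #in (suc n) k ≡ shift (#covered n) k
  #in-suc = trans (weightCount-split₃ (triple n) (λ r → chainOK false (true ∷ r)) k)
    (trans (+₈-cong (none 3) (none 2) (none 2) (none 1) (none 2) refl (none 1) (none 0)) (+-identityʳ _))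

  #covered-suc : #covered (suc n) k ≡ (shiftⁱ 2 (#in n) k + shift (#open n) k) + shift (#covered n) k
  #covered-suc = trans (weightCount-split₃ (triple n) (λ r → chainOK true (false ∷ r)) k)
    (trans (+₈-cong {c′ = shiftⁱ 2 (#in n) k} {d′ = shift (#open n) k}
                    (none 3) (none 2) refl refl (none 2) refl (none 1) (none 0))
           (cong (_+_ (shiftⁱ 2 (#in n) k + shift (#open n) k)) (+-identityʳ (shift (#covered n) k))))

  #open-suc : #open (suc n) k ≡ shiftⁱ 2 (#in n) k + shift (#open n) k
  #open-suc = trans (weightCount-split₃ (triple n) (λ r → chainOK false (false ∷ r)) k)
    (trans (+₈-cong {c′ = shiftⁱ 2 (#in n) k} {d′ = shift (#open n) k}
                    (none 3) (none 2) refl refl (none 2) (none 1) (none 1) (none 0))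
           (+-identityʳ _))

#covered≡#in+#open : ∀ n k → #covered n k ≡ #in n k + #open n k
#covered≡#in+#open zero    zero    = refl
#covered≡#in+#open zero    (suc k) = refl
#covered≡#in+#open (suc n) k       = begin
  #covered (suc n) k                                                   ≡⟨ #covered-suc n k ⟩
  (shiftⁱ 2 (#in n) k + shift (#open n) k) + shift (#covered n) k      ≡⟨ +-comm _ (shift (#covered n) k) ⟩
  shift (#covered n) k + (shiftⁱ 2 (#in n) k + shift (#open n) k)      ≡˘⟨ cong₂ _+_ (#in-suc n k) (#open-suc n k) ⟩
  #in (suc n) k + #open (suc n) k                                      ∎
  where open ≡-Reasoning

nextIn nextOpen misCount : (ℕ → ℕ) → (ℕ → ℕ) → ℕ → ℕ
nextIn   f g = shift (λ k → f k + g k)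
nextOpen f g k = shiftⁱ 2 f k + shift g k
misCount f g k = shift f k + g k

inSeq openSeq : ℕ → ℕ → ℕ
inSeq zero    zero    = 1
inSeq zero    (suc k) = 0
inSeq (suc n)         = nextIn (inSeq n) (openSeq n)
openSeq zero    k     = 0
openSeq (suc n)       = nextOpen (inSeq n) (openSeq n)

misSeq : ℕ → ℕ → ℕ
misSeq zero    zero    = 1
misSeq zero    (suc k) = 0
misSeq (suc n)         = misCount (inSeq (suc n)) (openSeq (suc n))

#in≗inSeq×#open≗openSeq : ∀ n → (∀ k → #in n k ≡ inSeq n k) × (∀ k → #open n k ≡ openSeq n k)
#in≗inSeq×#open≗openSeq zero = (λ { zero → refl ; (suc k) → refl }) , (λ { zero → refl ; (suc k) → refl })
#in≗inSeq×#open≗openSeq (suc n) = in≗ , open≗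
  where
  ih = #in≗inSeq×#open≗openSeq n
  in≗ : ∀ k → #in (suc n) k ≡ inSeq (suc n) k
  in≗ k = trans (#in-suc n k)
    (shift-cong (λ m → trans (#covered≡#in+#open n m) (cong₂ _+_ (proj₁ ih m) (proj₂ ih m))) k)
  open≗ : ∀ k → #open (suc n) k ≡ openSeq (suc n) k
  open≗ k = trans (#open-suc n k)
    (cong₂ _+_ (shift-cong (shift-cong (proj₁ ih)) k) (shift-cong (proj₂ ih) k))

transfer-identity : ∀ (f g : ℕ → ℕ) k →
  let f₁ = nextIn f g ; g₁ = nextOpen f g in
  misCount (nextIn f₁ g₁) (nextOpen f₁ g₁) k + shiftⁱ 2 (misCount f g) k
  ≡ (shift (misCount f₁ g₁) k + shift (misCount f₁ g₁) k) + shiftⁱ 3 (misCount f g) k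
transfer-identity f g zero                      = refl
transfer-identity f g (suc zero)                = refl
transfer-identity f g (suc (suc zero))          = ring (g 0)
  where
  ring : ∀ x → x + x ≡ x + x + 0
  ring = solve-∀
transfer-identity f g (suc (suc (suc zero)))    = ring (f 0) (g 0) (g 1)
  where
  ring : ∀ a b c → a + b + b + (a + b + (a + c)) + (a + c) ≡ a + b + (a + c) + (a + b + (a + c)) + b
  ring = solve-∀
transfer-identity f g (suc (suc (suc (suc k)))) = ring (f (suc k)) (g (suc k)) (f k) (g (suc (suc k)))
  where
  ring : ∀ p q r s → p + q + (r + q) + (p + q + (p + s)) + (p + s) ≡ p + q + (p + s) + (p + q + (p + s)) + (r + q)
  ring = solve-∀

misSeq-recurrence : ∀ j k →
  misSeq (3 + j) k + shiftⁱ 2 (misSeq (1 + j)) k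
  ≡ (shift (misSeq (2 + j)) k + shift (misSeq (2 + j)) k) + shiftⁱ 3 (misSeq (1 + j)) k
misSeq-recurrence j = transfer-identity (inSeq (suc j)) (openSeq (suc j))

denomTerms : List (ℤ × ℕ × ℕ)
denomTerms = (+ 1 , 0 , 0) ∷ (ℤ.- (+ 2) , 1 , 1) ∷ (+ 1 , 2 , 2) ∷ (ℤ.- (+ 1) , 2 , 3) ∷ []

misGF : PS
misGF n k = + misSeq n k

denom-relation : ∀ x y z w → x + z ≡ (y + y) + w →
  (+ 1 ℤ.* + x) ℤ.+ ((ℤ.- (+ 2) ℤ.* + y) ℤ.+ ((+ 1 ℤ.* + z) ℤ.+ ((ℤ.- (+ 1) ℤ.* + w) ℤ.+ 0ℤ))) ≡ 0ℤ
denom-relation x y z w eq = begin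
  (+ 1 ℤ.* + x) ℤ.+ ((ℤ.- (+ 2) ℤ.* + y) ℤ.+ ((+ 1 ℤ.* + z) ℤ.+ ((ℤ.- (+ 1) ℤ.* + w) ℤ.+ 0ℤ)))
    ≡⟨ ring (+ x) (+ y) (+ z) (+ w) ⟩
  (+ x ℤ.+ + z) ℤ.- ((+ y ℤ.+ + y) ℤ.+ + w)
    ≡⟨ cong (λ t → + (x + z) ℤ.- + t) (sym eq) ⟩
  + (x + z) ℤ.- + (x + z)
    ≡⟨ ℤ.+-inverseʳ (+ (x + z)) ⟩
  0ℤ ∎
  where
  open ≡-Reasoning
  ring : ∀ X Y Z W → (1ℤ ℤ.* X) ℤ.+ ((ℤ.- (+ 2) ℤ.* Y) ℤ.+ ((1ℤ ℤ.* Z) ℤ.+ ((ℤ.- 1ℤ ℤ.* W) ℤ.+ 0ℤ)))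
                     ≡ (X ℤ.+ Z) ℤ.- ((Y ℤ.+ Y) ℤ.+ W)
  ring = ℤ-Solver.solve-∀

-- Away from the boundary n, k ≥ 3 the coefficient vanishes by the recurrence; the
-- finitely many boundary coefficients are computed.
denom⊛misGF : ∀ n k → poly⊛ denomTerms misGF n k ≡ numer n k
denom⊛misGF 0 0                                 = refl
denom⊛misGF 0 (suc k)                           = refl
denom⊛misGF 1 0                                 = refl
denom⊛misGF 1 1                                 = refl
denom⊛misGF 1 2                                 = refl
denom⊛misGF 1 (suc (suc (suc k)))               = refl
denom⊛misGF 2 0                                 = refl
denom⊛misGF 2 1                                 = refl
denom⊛misGF 2 2                                 = refl
denom⊛misGF 2 3                                 = refl
denom⊛misGF 2 4                                 = refl
denom⊛misGF 2 (suc (suc (suc (suc (suc k))))) = refl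
denom⊛misGF (suc (suc (suc j))) 0 =
  denom-relation (misSeq (3 + j) 0) 0 0 0 (misSeq-recurrence j 0)
denom⊛misGF (suc (suc (suc j))) 1 =
  denom-relation (misSeq (3 + j) 1) (misSeq (2 + j) 0) 0 0 (misSeq-recurrence j 1)
denom⊛misGF (suc (suc (suc j))) 2 =
  denom-relation (misSeq (3 + j) 2) (misSeq (2 + j) 1) (misSeq (1 + j) 0) 0 (misSeq-recurrence j 2)
denom⊛misGF (suc (suc (suc j))) (suc (suc (suc k))) =
  denom-relation (misSeq (3 + j) (3 + k)) (misSeq (2 + j) (2 + k)) (misSeq (1 + j) (1 + k)) (misSeq (1 + j) k)
                 (misSeq-recurrence j (3 + k))

s≡misSeq : ∀ n k → s n k ≡ misSeq n k
s≡misSeq zero    zero    = refl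
s≡misSeq zero    (suc k) = refl
s≡misSeq (suc j) k       = begin
  s (suc j) k
    ≡⟨ length-filter≡countᵇ _ (allSubsets (nV (suc j))) ⟩
  countᵇ (λ S → maximalIndependent (adjS (suc j)) S ∧ (size S ≡ᵇ k)) (allSubsets (nV (suc j)))
    ≡⟨ countᵇ-cong (λ S → cong (_∧ (size S ≡ᵇ k)) (Cactus.maximalIndependent≡chainOK j S))
                   (allSubsets (nV (suc j))) ⟩
  countᵇ (λ S → chainOK false S ∧ (size S ≡ᵇ k)) (allSubsets (nV (suc j)))
    ≡⟨ countᵇ-allSubsets (nV (suc j)) (chainOK false) k ⟩
  weightCount (nV (suc j)) (chainOK false) k
    ≡⟨ cong (λ ℓ → weightCount ℓ (chainOK false) k) (nV-suc j) ⟩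
  shift (#in (suc j)) k + #open (suc j) k
    ≡⟨ cong₂ _+_ (shift-cong (proj₁ (#in≗inSeq×#open≗openSeq (suc j))) k)
                 (proj₂ (#in≗inSeq×#open≗openSeq (suc j)) k) ⟩
  misSeq (suc j) k ∎
  where open ≡-Reasoning

theorem2p7 : ∀ n k → (denom ⊛ sGF) n k ≡ numer n k
theorem2p7 n k = begin
  (denom ⊛ sGF) n k          ≡⟨ ⊛-congʳ denom (λ i j → cong +_ (s≡misSeq i j)) n k ⟩
  (denom ⊛ misGF) n k        ≡⟨ poly-⊛ denomTerms misGF n k ⟩
  poly⊛ denomTerms misGF n k ≡⟨ denom⊛misGF n k ⟩
  numer n k                  ∎
  where open ≡-Reasoning
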